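{- Let $\ell\geq 2$ and $a_1,\dots,a_\ell,b\in\mathbb{Z}_{\geq0}$, and let \[ \theta_{a_1,\dots,a_\ell,b}=\sum_{i=1}^\ell\left(\int_0^{x_i}t^b(t-x_1)^{a_1}\cdots(t-x_\ell)^{a_\ell}\,dt\right)\partial_i . \] Let $(\mathcal{A},m)$ be the multiarrangement in $\mathbb{C}^\ell$ with defining polynomial \[ Q(\mathcal{A},m)=\prod_{i=1}^\ell x_i^{a_i+b+1}\cdot\prod_{1\le i<j\le\ell}(x_i-x_j)^{a_i+a_j+1}. \] Then $\theta_{a_1,\dots,a_\ell,b}\in D(\mathcal{A},m)$.
   Context: $S=\mathbb{C}[x_1,\dots,x_\ell]$, $\partial_i=\partial/\partial x_i$, $\operatorname{Der}_S=\bigoplus_i S\partial_i$. For a multiarrangement $(\mathcal{A},m)$ (linear hyperplanes $H=\ker\alpha_H$ with multiplicities $m(H)\in\mathbb{Z}_{\ge0}$, defining polynomial $\prod_H\alpha_H^{m(H)}$), $D(\mathcal{A},m)=\{\delta\in\operatorname{Der}_S\mid\delta\alpha_H\in(\alpha_H^{m(H)})\ \forall H\in\mathcal{A}\}$. -}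

module Defs where

open import Data.Nat as ℕ using (ℕ; zero; suc)
open import Data.Fin using (Fin; _≟_) renaming (_<_ to _<ᶠ_)
open import Data.Rational as ℚ using (ℚ; 0ℚ; 1ℚ)
open import Data.Integer using (+_)
open import Data.List using (List; []; _∷_)
open import Data.Bool using (if_then_else_)
open import Data.Product using (Σ; ∃; _×_; _,_)
open import Data.Sum using (_⊎_; inj₁; inj₂)
open import Relation.Nullary.Decidable using (⌊_⌋)
open import Relation.Binary.PropositionalEquality using (_≡_)

-- Polynomials in ℓ variables x₀,…,x_{ℓ-1} (rational coefficients),
-- given as expressions; two expressions denote the same polynomial
-- iff they agree as functions on ℚ^ℓ (ℚ is infinite, so this is
-- exactly equality in ℚ[x₁,…,x_ℓ]).

infixl 6 _⊕_
infixl 7 _⊗_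

data Poly (ℓ : ℕ) : Set where
  con : ℚ → Poly ℓ
  var : Fin ℓ → Poly ℓ
  _⊕_ : Poly ℓ → Poly ℓ → Poly ℓ
  _⊗_ : Poly ℓ → Poly ℓ → Poly ℓ

eval : ∀ {ℓ} → Poly ℓ → (Fin ℓ → ℚ) → ℚ
eval (con c) x = c
eval (var i) x = x i
eval (p ⊕ q) x = eval p x ℚ.+ eval q x
eval (p ⊗ q) x = eval p x ℚ.* eval q x

_≈P_ : ∀ {ℓ} → Poly ℓ → Poly ℓ → Set
p ≈P q = ∀ x → eval p x ≡ eval q x

_^P_ : ∀ {ℓ} → Poly ℓ → ℕ → Poly ℓ
p ^P zero = con 1ℚ
p ^P suc n = p ⊗ (p ^P n)

negP : ∀ {ℓ} → Poly ℓ → Poly ℓ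
negP p = con (ℚ.- 1ℚ) ⊗ p

_∣P_ : ∀ {ℓ} → Poly ℓ → Poly ℓ → Set
p ∣P q = ∃ λ r → q ≈P (p ⊗ r)

sumP : ∀ {ℓ} (n : ℕ) → (Fin n → Poly ℓ) → Poly ℓ
sumP zero f = con 0ℚ
sumP (suc n) f = f Fin.zero ⊕ sumP n (λ k → f (Fin.suc k))

LinForm : ℕ → Set
LinForm ℓ = Fin ℓ → ℚ

linPoly : ∀ {ℓ} → LinForm ℓ → Poly ℓ
linPoly {ℓ} α = sumP ℓ (λ k → con (α k) ⊗ var k)

-- δ = Σ_k δ k ∂_k
Der : ℕ → Set
Der ℓ = Fin ℓ → Poly ℓ

applyDer : ∀ {ℓ} → Der ℓ → LinForm ℓ → Poly ℓ
applyDer {ℓ} δ α = sumP ℓ (λ k → con (α k) ⊗ δ k)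

-- a multiarrangement: hyperplanes H = ker α_H indexed by Idx,
-- with multiplicities m(H)
record MultiArr (ℓ : ℕ) : Set₁ where
  field
    Idx  : Set
    form : Idx → LinForm ℓ
    mult : Idx → ℕ

_∈D_ : ∀ {ℓ} → Der ℓ → MultiArr ℓ → Set
δ ∈D A = ∀ h → (linPoly (form h) ^P mult h) ∣P applyDer δ (form h)
  where open MultiArr A

coord : ∀ {ℓ} → Fin ℓ → LinForm ℓ
coord i k = if ⌊ k ≟ i ⌋ then 1ℚ else 0ℚ

diffForm : ∀ {ℓ} → Fin ℓ → Fin ℓ → LinForm ℓ
diffForm i j k = coord i k ℚ.- coord j k

arr : ∀ {ℓ} → (Fin ℓ → ℕ) → ℕ → MultiArr ℓ
arr {ℓ} a b = record
  { Idx  = Fin ℓ ⊎ Σ (Fin ℓ × Fin ℓ) (λ { (i , j) → i <ᶠ j })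
  ; form = λ { (inj₁ i) → coord i ; (inj₂ ((i , j) , _)) → diffForm i j }
  ; mult = λ { (inj₁ i) → a i ℕ.+ b ℕ.+ 1
             ; (inj₂ ((i , j) , _)) → a i ℕ.+ a j ℕ.+ 1 }
  }

-- Univariate polynomials in t with coefficients in Poly ℓ
-- (coefficient list, constant term first)

UPoly : ℕ → Set
UPoly ℓ = List (Poly ℓ)

addU : ∀ {ℓ} → UPoly ℓ → UPoly ℓ → UPoly ℓ
addU [] q = q
addU (c ∷ p) [] = c ∷ p
addU (c ∷ p) (d ∷ q) = (c ⊕ d) ∷ addU p q

scaleU : ∀ {ℓ} → Poly ℓ → UPoly ℓ → UPoly ℓ
scaleU c [] = []
scaleU c (d ∷ q) = (c ⊗ d) ∷ scaleU c q

mulU : ∀ {ℓ} → UPoly ℓ → UPoly ℓ → UPoly ℓ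
mulU [] q = []
mulU (c ∷ p) q = addU (scaleU c q) (con 0ℚ ∷ mulU p q)

powU : ∀ {ℓ} → UPoly ℓ → ℕ → UPoly ℓ
powU p zero = con 1ℚ ∷ []
powU p (suc n) = mulU p (powU p n)

prodU : ∀ {ℓ} (n : ℕ) → (Fin n → UPoly ℓ) → UPoly ℓ
prodU zero f = con 1ℚ ∷ []
prodU (suc n) f = mulU (f Fin.zero) (prodU n (λ k → f (Fin.suc k)))

tU : ∀ {ℓ} → UPoly ℓ
tU = con 0ℚ ∷ con 1ℚ ∷ []

tMinus : ∀ {ℓ} → Fin ℓ → UPoly ℓ
tMinus j = negP (var j) ∷ con 1ℚ ∷ []

intFrom : ∀ {ℓ} → ℕ → UPoly ℓ → Poly ℓ → Poly ℓ
intFrom k [] s = con 0ℚ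
intFrom k (c ∷ cs) s =
  (con ((+ 1) ℚ./ suc k) ⊗ c ⊗ (s ^P suc k)) ⊕ intFrom (suc k) cs s

integral0 : ∀ {ℓ} → UPoly ℓ → Poly ℓ → Poly ℓ
integral0 = intFrom 0

integrand : ∀ {ℓ} → (Fin ℓ → ℕ) → ℕ → UPoly ℓ
integrand {ℓ} a b = mulU (powU tU b) (prodU ℓ (λ j → powU (tMinus j) (a j)))

θ : ∀ {ℓ} → (Fin ℓ → ℕ) → ℕ → Der ℓ
θ a b i = integral0 (integrand a b) (var i)

-- With f the integrand and F(s) = ∫_0^s f, the coefficient θ_i is F(x_i), so for
-- H = ker x_i resp. H = ker(x_i - x_j) the polynomial θ(α_H) is ∫_v^{v+w} f with
-- v = 0 resp. v = x_j and w = α_H. On this interval f vanishes to order p at the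
-- upper end v + w and to order q at the lower end v, where p + q + 1 = m(H), so the
-- substitution t = v + w s gives
--   ∫_v^{v+w} f = w^(p+q+1) ∫_0^1 (s - 1)^p s^q h(v + w s) ds,
-- a polynomial multiple of α_H^m(H). Identities in ℚ[t] are checked pointwise;
-- substitution follows from the chain rule and the uniqueness of antiderivatives,
-- which in turn rests on a polynomial vanishing on ℕ having zero coefficients.

module Submission where

open import Defs
open import Data.Nat as ℕ using (ℕ; zero; suc; _≥_; _≤_; _<_; z≤n; s≤s)
import Data.Nat.Properties as ℕ
open import Data.Integer using (+_)
import Data.Integer as ℤ
import Data.Integer.Properties as ℤ
open import Data.Rational using (ℚ; toℚᵘ; 0ℚ; 1ℚ; _+_; _*_; _-_; -_; _/_; 1/_; NonZero; ≢-nonZero)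
import Data.Rational.Properties as ℚ
import Data.Rational.Unnormalised as ℚᵘ
import Data.Rational.Unnormalised.Properties as ℚᵘ
open import Data.Rational.Solver using (module +-*-Solver)
open import Data.Fin using (Fin; _≟_; punchIn) renaming (zero to fzero; suc to fsuc)
open import Data.Fin.Properties using (punchInᵢ≢i; <⇒≢)
open import Data.List using (List; []; _∷_; length; map)
open import Data.Product using (_,_)
open import Data.Sum using (inj₁; inj₂)
open import Function using (_∘_)
open import Data.Vec.Functional using (updateAt)
open import Data.Vec.Functional.Properties using (updateAt-updates; updateAt-minimal)
open import Relation.Nullary using (yes; no; contradiction)
open import Relation.Binary.PropositionalEquality
open import Algebra.Bundles using (CommutativeRing)
open import Algebra.Properties.Group ℚ.+-0-group using (x∙y⁻¹≈ε⇒x≈y; x≈y⇒x∙y⁻¹≈ε)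
open import Algebra.Properties.CommutativeSemiring.Exp
  (CommutativeRing.commutativeSemiring ℚ.+-*-commutativeRing) using (_^_; ^-distrib-*; ^-homo-*)
open import Algebra.Properties.Semiring.Sum (CommutativeRing.semiring ℚ.+-*-commutativeRing)
  using (sum-remove; sum-cong-≗; sum-replicate-zero; ∑-distrib-+; *-distribˡ-sum) renaming (sum to ∑)
open import Algebra.Properties.CommutativeMonoid.Sum ℚ.*-1-commutativeMonoid
  using () renaming (sum to ∏; sum-remove to ∏-remove; sum-cong-≗ to ∏-cong-≗)
open +-*-Solver using (solve; _:=_; _:+_; _:*_; _:-_) renaming (con to κ)

fromℕ : ℕ → ℚ
fromℕ n = + n / 1

fromℕ-injective : ∀ {m n} → fromℕ m ≡ fromℕ n → m ≡ n
fromℕ-injective {m} {n} eq with ℚ./-injective-≃ (ℚᵘ.mkℚᵘ (+ m) 0) (ℚᵘ.mkℚᵘ (+ n) 0) eq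
... | ℚᵘ.*≡* m*1≡n*1 = ℤ.+-injective (ℤ.*-cancelʳ-≡ (+ m) (+ n) (+ 1) m*1≡n*1)

fromℕ-suc : ∀ n → fromℕ (suc n) ≡ 1ℚ + fromℕ n
fromℕ-suc n = ℚ.toℚᵘ-injective (begin
  toℚᵘ (fromℕ (suc n))
    ≈⟨ ℚ.toℚᵘ-fromℚᵘ (ℚᵘ.mkℚᵘ (+ suc n) 0) ⟩
  ℚᵘ.mkℚᵘ (+ suc n) 0
    ≡⟨ cong (λ z → ℚᵘ.mkℚᵘ (+ 1 ℤ.+ z) 0) (ℤ.*-identityʳ (+ n)) ⟨
  ℚᵘ.mkℚᵘ (+ 1) 0 ℚᵘ.+ ℚᵘ.mkℚᵘ (+ n) 0
    ≈⟨ ℚᵘ.+-cong (ℚ.toℚᵘ-fromℚᵘ (ℚᵘ.mkℚᵘ (+ 1) 0)) (ℚ.toℚᵘ-fromℚᵘ (ℚᵘ.mkℚᵘ (+ n) 0)) ⟨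
  toℚᵘ 1ℚ ℚᵘ.+ toℚᵘ (fromℕ n)
    ≈⟨ ℚ.toℚᵘ-homo-+ 1ℚ (fromℕ n) ⟨
  toℚᵘ (1ℚ + fromℕ n)
    ∎)
  where open ℚᵘ.≃-Reasoning

1/[1+k]*[1+k]≡1 : ∀ k → (+ 1 / suc k) * fromℕ (suc k) ≡ 1ℚ
1/[1+k]*[1+k]≡1 k = ℚ.toℚᵘ-injective (begin
  toℚᵘ ((+ 1 / suc k) * fromℕ (suc k))
    ≈⟨ ℚ.toℚᵘ-homo-* (+ 1 / suc k) (fromℕ (suc k)) ⟩
  toℚᵘ (+ 1 / suc k) ℚᵘ.* toℚᵘ (fromℕ (suc k))
    ≈⟨ ℚᵘ.*-cong (ℚ.toℚᵘ-fromℚᵘ (ℚᵘ.mkℚᵘ (+ 1) k)) (ℚ.toℚᵘ-fromℚᵘ (ℚᵘ.mkℚᵘ (+ suc k) 0)) ⟩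
  ℚᵘ.mkℚᵘ (+ 1) k ℚᵘ.* ℚᵘ.mkℚᵘ (+ suc k) 0
    ≈⟨ ℚᵘ.*≡* (cong (λ m → + suc m) (trans (cong (ℕ._* 1) (ℕ.+-identityʳ k)) (sym (ℕ.+-identityʳ (k ℕ.* 1))))) ⟩
  toℚᵘ 1ℚ
    ∎)
  where open ℚᵘ.≃-Reasoning

cancelˡ-≢0 : ∀ x {y} → x ≢ 0ℚ → x * y ≡ 0ℚ → y ≡ 0ℚ
cancelˡ-≢0 x {y} x≢0 xy≡0 = begin
  y                  ≡⟨ ℚ.*-identityˡ y ⟨
  1ℚ * y             ≡⟨ cong (_* y) (ℚ.*-inverseˡ x) ⟨
  (1/ x) * x * y     ≡⟨ ℚ.*-assoc (1/ x) x y ⟩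
  (1/ x) * (x * y)   ≡⟨ cong ((1/ x) *_) xy≡0 ⟩
  (1/ x) * 0ℚ        ≡⟨ ℚ.*-zeroʳ (1/ x) ⟩
  0ℚ                 ∎
  where
  open ≡-Reasoning
  instance
    x-nonZero : NonZero x
    x-nonZero = ≢-nonZero x≢0

ℚ[t] : Set
ℚ[t] = List ℚ

⟦_⟧ : ℚ[t] → ℚ → ℚ
⟦ [] ⟧    t = 0ℚ
⟦ c ∷ p ⟧ t = c + t * ⟦ p ⟧ t

coeff : ℚ[t] → ℕ → ℚ
coeff []      n       = 0ℚ
coeff (c ∷ p) zero    = c
coeff (c ∷ p) (suc n) = coeff p n

-- The ring operations follow addU, scaleU, mulU, powU and prodU clause by clause,
-- so specialising coefficients commutes with them up to ≡ of lists.
infixl 6 _+ₚ_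
infixl 7 _*ₚ_ _·ₚ_
infixr 8 _^ₚ_
infixr 9 _∘ₚ_

_+ₚ_ : ℚ[t] → ℚ[t] → ℚ[t]
[]      +ₚ q       = q
(c ∷ p) +ₚ []      = c ∷ p
(c ∷ p) +ₚ (d ∷ q) = (c + d) ∷ (p +ₚ q)

_·ₚ_ : ℚ → ℚ[t] → ℚ[t]
c ·ₚ []      = []
c ·ₚ (d ∷ q) = (c * d) ∷ (c ·ₚ q)

_*ₚ_ : ℚ[t] → ℚ[t] → ℚ[t]
[]      *ₚ q = []
(c ∷ p) *ₚ q = c ·ₚ q +ₚ (0ℚ ∷ p *ₚ q)

_^ₚ_ : ℚ[t] → ℕ → ℚ[t]
p ^ₚ zero  = 1ℚ ∷ []
p ^ₚ suc n = p *ₚ p ^ₚ n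

∏ₚ : (n : ℕ) → (Fin n → ℚ[t]) → ℚ[t]
∏ₚ zero    f = 1ℚ ∷ []
∏ₚ (suc n) f = f fzero *ₚ ∏ₚ n (f ∘ fsuc)

_∘ₚ_ : ℚ[t] → ℚ[t] → ℚ[t]
[]      ∘ₚ L = []
(c ∷ p) ∘ₚ L = (c ∷ []) +ₚ L *ₚ (p ∘ₚ L)

affine : ℚ → ℚ → ℚ[t]
affine v w = v ∷ w ∷ []

⟦⟧-homo-+ : ∀ p q t → ⟦ p +ₚ q ⟧ t ≡ ⟦ p ⟧ t + ⟦ q ⟧ t
⟦⟧-homo-+ []      q       t = sym (ℚ.+-identityˡ (⟦ q ⟧ t))
⟦⟧-homo-+ (c ∷ p) []      t = sym (ℚ.+-identityʳ (⟦ c ∷ p ⟧ t))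
⟦⟧-homo-+ (c ∷ p) (d ∷ q) t rewrite ⟦⟧-homo-+ p q t =
  solve 5 (λ c d t P Q → (c :+ d) :+ t :* (P :+ Q) := (c :+ t :* P) :+ (d :+ t :* Q))
    refl c d t (⟦ p ⟧ t) (⟦ q ⟧ t)

⟦⟧-homo-· : ∀ c q t → ⟦ c ·ₚ q ⟧ t ≡ c * ⟦ q ⟧ t
⟦⟧-homo-· c []      t = sym (ℚ.*-zeroʳ c)
⟦⟧-homo-· c (d ∷ q) t rewrite ⟦⟧-homo-· c q t =
  solve 4 (λ c d t Q → c :* d :+ t :* (c :* Q) := c :* (d :+ t :* Q)) refl c d t (⟦ q ⟧ t)

⟦⟧-homo-* : ∀ p q t → ⟦ p *ₚ q ⟧ t ≡ ⟦ p ⟧ t * ⟦ q ⟧ t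
⟦⟧-homo-* []      q t = sym (ℚ.*-zeroˡ (⟦ q ⟧ t))
⟦⟧-homo-* (c ∷ p) q t
  rewrite ⟦⟧-homo-+ (c ·ₚ q) (0ℚ ∷ p *ₚ q) t | ⟦⟧-homo-· c q t | ⟦⟧-homo-* p q t =
  solve 4 (λ c t P Q → c :* Q :+ (κ 0ℚ :+ t :* (P :* Q)) := (c :+ t :* P) :* Q)
    refl c t (⟦ p ⟧ t) (⟦ q ⟧ t)

⟦const⟧ : ∀ c t → ⟦ c ∷ [] ⟧ t ≡ c
⟦const⟧ c t = solve 2 (λ c t → c :+ t :* κ 0ℚ := c) refl c t

⟦⟧-homo-^ : ∀ p n t → ⟦ p ^ₚ n ⟧ t ≡ ⟦ p ⟧ t ^ n
⟦⟧-homo-^ p zero    t = ⟦const⟧ 1ℚ t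
⟦⟧-homo-^ p (suc n) t = trans (⟦⟧-homo-* p (p ^ₚ n) t) (cong (⟦ p ⟧ t *_) (⟦⟧-homo-^ p n t))

⟦⟧-homo-∏ : ∀ n f t → ⟦ ∏ₚ n f ⟧ t ≡ ∏ (λ k → ⟦ f k ⟧ t)
⟦⟧-homo-∏ zero    f t = ⟦const⟧ 1ℚ t
⟦⟧-homo-∏ (suc n) f t =
  trans (⟦⟧-homo-* (f fzero) (∏ₚ n (f ∘ fsuc)) t) (cong (⟦ f fzero ⟧ t *_) (⟦⟧-homo-∏ n (f ∘ fsuc) t))

⟦⟧-homo-∘ : ∀ p L t → ⟦ p ∘ₚ L ⟧ t ≡ ⟦ p ⟧ (⟦ L ⟧ t)
⟦⟧-homo-∘ []      L t = refl
⟦⟧-homo-∘ (c ∷ p) L t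
  rewrite ⟦⟧-homo-+ (c ∷ []) (L *ₚ (p ∘ₚ L)) t | ⟦const⟧ c t
        | ⟦⟧-homo-* L (p ∘ₚ L) t | ⟦⟧-homo-∘ p L t = refl

⟦affine⟧ : ∀ v w s → ⟦ affine v w ⟧ s ≡ v + w * s
⟦affine⟧ = solve 3 (λ v w s → v :+ s :* (w :+ s :* κ 0ℚ) := v :+ w :* s) refl

∂ : ℚ[t] → ℚ[t]
∂ []      = []
∂ (c ∷ p) = p +ₚ (0ℚ ∷ ∂ p)

⟦∂∷⟧ : ∀ c p t → ⟦ ∂ (c ∷ p) ⟧ t ≡ ⟦ p ⟧ t + t * ⟦ ∂ p ⟧ t
⟦∂∷⟧ c p t rewrite ⟦⟧-homo-+ p (0ℚ ∷ ∂ p) t = cong (_+_ (⟦ p ⟧ t)) (ℚ.+-identityˡ _)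

∂-homo-+ : ∀ p q t → ⟦ ∂ (p +ₚ q) ⟧ t ≡ ⟦ ∂ p ⟧ t + ⟦ ∂ q ⟧ t
∂-homo-+ []      q       t = sym (ℚ.+-identityˡ _)
∂-homo-+ (c ∷ p) []      t = sym (ℚ.+-identityʳ _)
∂-homo-+ (c ∷ p) (d ∷ q) t
  rewrite ⟦∂∷⟧ (c + d) (p +ₚ q) t | ⟦⟧-homo-+ p q t | ∂-homo-+ p q t
        | ⟦∂∷⟧ c p t | ⟦∂∷⟧ d q t =
  solve 5 (λ P Q t P′ Q′ → (P :+ Q) :+ t :* (P′ :+ Q′) := (P :+ t :* P′) :+ (Q :+ t :* Q′))
    refl (⟦ p ⟧ t) (⟦ q ⟧ t) t (⟦ ∂ p ⟧ t) (⟦ ∂ q ⟧ t)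

∂-homo-· : ∀ c p t → ⟦ ∂ (c ·ₚ p) ⟧ t ≡ c * ⟦ ∂ p ⟧ t
∂-homo-· c []      t = sym (ℚ.*-zeroʳ c)
∂-homo-· c (d ∷ p) t
  rewrite ⟦∂∷⟧ (c * d) (c ·ₚ p) t | ⟦⟧-homo-· c p t | ∂-homo-· c p t | ⟦∂∷⟧ d p t =
  solve 4 (λ c P t P′ → c :* P :+ t :* (c :* P′) := c :* (P :+ t :* P′))
    refl c (⟦ p ⟧ t) t (⟦ ∂ p ⟧ t)

∂-const : ∀ c t → ⟦ ∂ (c ∷ []) ⟧ t ≡ 0ℚ
∂-const c t = solve 1 (λ t → κ 0ℚ :+ t :* κ 0ℚ := κ 0ℚ) refl t

∂-leibniz : ∀ p q t → ⟦ ∂ (p *ₚ q) ⟧ t ≡ ⟦ ∂ p ⟧ t * ⟦ q ⟧ t + ⟦ p ⟧ t * ⟦ ∂ q ⟧ t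
∂-leibniz []      q t = solve 2 (λ Q Q′ → κ 0ℚ := κ 0ℚ :* Q :+ κ 0ℚ :* Q′) refl (⟦ q ⟧ t) (⟦ ∂ q ⟧ t)
∂-leibniz (c ∷ p) q t
  rewrite ∂-homo-+ (c ·ₚ q) (0ℚ ∷ p *ₚ q) t | ∂-homo-· c q t | ⟦∂∷⟧ 0ℚ (p *ₚ q) t
        | ⟦⟧-homo-* p q t | ∂-leibniz p q t | ⟦∂∷⟧ c p t =
  solve 6 (λ c t P Q P′ Q′ → c :* Q′ :+ (P :* Q :+ t :* (P′ :* Q :+ P :* Q′))
                             := (P :+ t :* P′) :* Q :+ (c :+ t :* P) :* Q′)
    refl c t (⟦ p ⟧ t) (⟦ q ⟧ t) (⟦ ∂ p ⟧ t) (⟦ ∂ q ⟧ t)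

∂-chain : ∀ p L t → ⟦ ∂ (p ∘ₚ L) ⟧ t ≡ ⟦ ∂ L ⟧ t * ⟦ ∂ p ⟧ (⟦ L ⟧ t)
∂-chain []      L t = sym (ℚ.*-zeroʳ (⟦ ∂ L ⟧ t))
∂-chain (c ∷ p) L t
  rewrite ∂-homo-+ (c ∷ []) (L *ₚ (p ∘ₚ L)) t | ∂-const c t | ∂-leibniz L (p ∘ₚ L) t
        | ⟦⟧-homo-∘ p L t | ∂-chain p L t | ⟦∂∷⟧ c p (⟦ L ⟧ t) =
  solve 4 (λ L′ Lt P P′ → κ 0ℚ :+ (L′ :* P :+ Lt :* (L′ :* P′)) := L′ :* (P :+ Lt :* P′))
    refl (⟦ ∂ L ⟧ t) (⟦ L ⟧ t) (⟦ p ⟧ (⟦ L ⟧ t)) (⟦ ∂ p ⟧ (⟦ L ⟧ t))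

∂-affine : ∀ v w t → ⟦ ∂ (affine v w) ⟧ t ≡ w
∂-affine v w = solve 2 (λ w t → (w :+ κ 0ℚ) :+ t :* (κ 0ℚ :+ t :* κ 0ℚ) := w) refl w

-- Coefficients and the identity theorem

coeff-+ₚ : ∀ p q n → coeff (p +ₚ q) n ≡ coeff p n + coeff q n
coeff-+ₚ []      q       n       = sym (ℚ.+-identityˡ _)
coeff-+ₚ (c ∷ p) []      zero    = sym (ℚ.+-identityʳ _)
coeff-+ₚ (c ∷ p) []      (suc n) = sym (ℚ.+-identityʳ _)
coeff-+ₚ (c ∷ p) (d ∷ q) zero    = refl
coeff-+ₚ (c ∷ p) (d ∷ q) (suc n) = coeff-+ₚ p q n

coeff-∂ : ∀ p n → coeff (∂ p) n ≡ fromℕ (suc n) * coeff p (suc n)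
coeff-∂ []      n = sym (ℚ.*-zeroʳ (fromℕ (suc n)))
coeff-∂ (c ∷ p) zero rewrite coeff-+ₚ p (0ℚ ∷ ∂ p) zero =
  solve 1 (λ P → P :+ κ 0ℚ := κ 1ℚ :* P) refl (coeff p 0)
coeff-∂ (c ∷ p) (suc n)
  rewrite coeff-+ₚ p (0ℚ ∷ ∂ p) (suc n) | coeff-∂ p n | fromℕ-suc (suc n) =
  solve 2 (λ P N → P :+ N :* P := (κ 1ℚ :+ N) :* P) refl (coeff p (suc n)) (fromℕ (suc n))

⟦⟧-at-0 : ∀ p → ⟦ p ⟧ 0ℚ ≡ coeff p 0
⟦⟧-at-0 []      = refl
⟦⟧-at-0 (c ∷ p) = solve 2 (λ c P → c :+ κ 0ℚ :* P := c) refl c (⟦ p ⟧ 0ℚ)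

coeff≗0⇒⟦⟧≡0 : ∀ p → (∀ n → coeff p n ≡ 0ℚ) → ∀ t → ⟦ p ⟧ t ≡ 0ℚ
coeff≗0⇒⟦⟧≡0 []      p≗0 t = refl
coeff≗0⇒⟦⟧≡0 (c ∷ p) p≗0 t rewrite p≗0 0 | coeff≗0⇒⟦⟧≡0 p (p≗0 ∘ suc) t =
  solve 1 (λ t → κ 0ℚ :+ t :* κ 0ℚ := κ 0ℚ) refl t

coeff-ext : ∀ p q → (∀ n → coeff p n ≡ coeff q n) → ∀ t → ⟦ p ⟧ t ≡ ⟦ q ⟧ t
coeff-ext []      q       p≗q t = sym (coeff≗0⇒⟦⟧≡0 q (sym ∘ p≗q) t)
coeff-ext (c ∷ p) []      p≗q t = coeff≗0⇒⟦⟧≡0 (c ∷ p) p≗q t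
coeff-ext (c ∷ p) (d ∷ q) p≗q t rewrite p≗q 0 | coeff-ext p q (p≗q ∘ suc) t = refl

-- Horner's scheme for dividing by t - a: the quotient's coefficients are
-- the partial evaluations at a.
divide : ℚ → ℚ[t] → ℚ[t]
divide a []          = []
divide a (c ∷ [])    = []
divide a (c ∷ d ∷ p) = ⟦ d ∷ p ⟧ a ∷ divide a (d ∷ p)

⟦⟧-division : ∀ a p t → ⟦ p ⟧ t ≡ (t - a) * ⟦ divide a p ⟧ t + ⟦ p ⟧ a
⟦⟧-division a []          t = solve 2 (λ a t → κ 0ℚ := (t :- a) :* κ 0ℚ :+ κ 0ℚ) refl a t
⟦⟧-division a (c ∷ [])    t =
  solve 3 (λ a c t → c :+ t :* κ 0ℚ := (t :- a) :* κ 0ℚ :+ (c :+ a :* κ 0ℚ)) refl a c t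
⟦⟧-division a (c ∷ d ∷ p) t rewrite ⟦⟧-division a (d ∷ p) t =
  solve 5 (λ a c t Q R → c :+ t :* ((t :- a) :* Q :+ R) := (t :- a) :* (R :+ t :* Q) :+ (c :+ a :* R))
    refl a c t (⟦ divide a (d ∷ p) ⟧ t) (⟦ d ∷ p ⟧ a)

divide-length : ∀ a p {n} → length p ≤ suc n → length (divide a p) ≤ n
divide-length a []          _                   = z≤n
divide-length a (c ∷ [])    _                   = z≤n
divide-length a (c ∷ d ∷ p) {suc n} (s≤s |p|≤n) = s≤s (divide-length a (d ∷ p) |p|≤n)

root∧divide≗0⇒coeff≗0 : ∀ a p → ⟦ p ⟧ a ≡ 0ℚ → (∀ n → coeff (divide a p) n ≡ 0ℚ) →
                         ∀ n → coeff p n ≡ 0ℚ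
root∧divide≗0⇒coeff≗0 a []          _    _   n       = refl
root∧divide≗0⇒coeff≗0 a (c ∷ [])    p[a] _   zero    =
  trans (solve 2 (λ a c → c := c :+ a :* κ 0ℚ) refl a c) p[a]
root∧divide≗0⇒coeff≗0 a (c ∷ [])    _    _   (suc n) = refl
root∧divide≗0⇒coeff≗0 a (c ∷ d ∷ p) p[a] q≗0 zero    = begin
  c                       ≡⟨ solve 2 (λ a c → c := c :+ a :* κ 0ℚ) refl a c ⟩
  c + a * 0ℚ              ≡⟨ cong (λ r → c + a * r) (q≗0 0) ⟨
  c + a * ⟦ d ∷ p ⟧ a     ≡⟨ p[a] ⟩
  0ℚ                      ∎
  where open ≡-Reasoning
root∧divide≗0⇒coeff≗0 a (c ∷ d ∷ p) _    q≗0 (suc n) =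
  root∧divide≗0⇒coeff≗0 a (d ∷ p) (q≗0 0) (q≗0 ∘ suc) n

fromℕ[1+n]≢0 : ∀ n → fromℕ (suc n) ≢ 0ℚ
fromℕ[1+n]≢0 n eq with fromℕ-injective {suc n} {0} eq
... | ()

-- Induction on n: dividing by t - (n - 1) leaves a polynomial with one
-- coefficient fewer that still vanishes at 0, …, n - 2.
vanishing-on-fromℕ⇒coeff≗0 : ∀ n p → length p ≤ n → (∀ k → k < n → ⟦ p ⟧ (fromℕ k) ≡ 0ℚ) →
                              ∀ m → coeff p m ≡ 0ℚ
vanishing-on-fromℕ⇒coeff≗0 zero    []  _    _    m = refl
vanishing-on-fromℕ⇒coeff≗0 (suc n) p |p|≤1+n p≗0 =
  root∧divide≗0⇒coeff≗0 a p p[a]≡0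
    (vanishing-on-fromℕ⇒coeff≗0 n (divide a p) (divide-length a p |p|≤1+n) q-vanishes)
  where
  a = fromℕ n
  p[a]≡0 : ⟦ p ⟧ a ≡ 0ℚ
  p[a]≡0 = p≗0 n (ℕ.n<1+n n)
  q-vanishes : ∀ k → k < n → ⟦ divide a p ⟧ (fromℕ k) ≡ 0ℚ
  q-vanishes k k<n = cancelˡ-≢0 (fromℕ k - a) k-a≢0 (begin
    (fromℕ k - a) * ⟦ divide a p ⟧ (fromℕ k)           ≡⟨ ℚ.+-identityʳ _ ⟨
    (fromℕ k - a) * ⟦ divide a p ⟧ (fromℕ k) + 0ℚ      ≡⟨ cong (_+_ ((fromℕ k - a) * ⟦ divide a p ⟧ (fromℕ k))) p[a]≡0 ⟨
    (fromℕ k - a) * ⟦ divide a p ⟧ (fromℕ k) + ⟦ p ⟧ a ≡⟨ ⟦⟧-division a p (fromℕ k) ⟨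
    ⟦ p ⟧ (fromℕ k)                                      ≡⟨ p≗0 k (ℕ.m<n⇒m<1+n k<n) ⟩
    0ℚ                                                   ∎)
    where
    open ≡-Reasoning
    k-a≢0 : fromℕ k - a ≢ 0ℚ
    k-a≢0 k-a≡0 = ℕ.<-irrefl (fromℕ-injective (x∙y⁻¹≈ε⇒x≈y _ _ k-a≡0)) k<n

vanishing⇒coeff≗0 : ∀ p → (∀ t → ⟦ p ⟧ t ≡ 0ℚ) → ∀ n → coeff p n ≡ 0ℚ
vanishing⇒coeff≗0 p p≗0 = vanishing-on-fromℕ⇒coeff≗0 (length p) p ℕ.≤-refl (λ k _ → p≗0 (fromℕ k))

-- Antiderivatives

∂≗0⇒constant : ∀ p → (∀ t → ⟦ ∂ p ⟧ t ≡ 0ℚ) → ∀ t → ⟦ p ⟧ t ≡ ⟦ p ⟧ 0ℚ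
∂≗0⇒constant p ∂p≗0 t = begin
  ⟦ p ⟧ t                ≡⟨ coeff-ext p (coeff p 0 ∷ []) higher≗0 t ⟩
  ⟦ coeff p 0 ∷ [] ⟧ t   ≡⟨ ⟦const⟧ (coeff p 0) t ⟩
  coeff p 0              ≡⟨ ⟦⟧-at-0 p ⟨
  ⟦ p ⟧ 0ℚ               ∎
  where
  open ≡-Reasoning
  higher≗0 : ∀ n → coeff p n ≡ coeff (coeff p 0 ∷ []) n
  higher≗0 zero    = refl
  higher≗0 (suc n) = cancelˡ-≢0 (fromℕ (suc n)) (fromℕ[1+n]≢0 n)
    (trans (sym (coeff-∂ p n)) (vanishing⇒coeff≗0 (∂ p) ∂p≗0 n))

∂-injective : ∀ p q → (∀ t → ⟦ ∂ p ⟧ t ≡ ⟦ ∂ q ⟧ t) → ⟦ p ⟧ 0ℚ ≡ ⟦ q ⟧ 0ℚ →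
              ∀ t → ⟦ p ⟧ t ≡ ⟦ q ⟧ t
∂-injective p q ∂p≗∂q p₀≡q₀ t = x∙y⁻¹≈ε⇒x≈y _ _ (begin
  ⟦ p ⟧ t - ⟦ q ⟧ t     ≡⟨ ⟦r⟧ t ⟨
  ⟦ r ⟧ t               ≡⟨ ∂≗0⇒constant r ∂r≗0 t ⟩
  ⟦ r ⟧ 0ℚ              ≡⟨ ⟦r⟧ 0ℚ ⟩
  ⟦ p ⟧ 0ℚ - ⟦ q ⟧ 0ℚ   ≡⟨ x≈y⇒x∙y⁻¹≈ε p₀≡q₀ ⟩
  0ℚ                    ∎)
  where
  open ≡-Reasoning
  r = p +ₚ (- 1ℚ) ·ₚ q
  minus-one : ∀ x y → x + (- 1ℚ) * y ≡ x - y
  minus-one = solve 2 (λ x y → x :+ κ (- 1ℚ) :* y := x :- y) refl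
  ⟦r⟧ : ∀ t → ⟦ r ⟧ t ≡ ⟦ p ⟧ t - ⟦ q ⟧ t
  ⟦r⟧ t rewrite ⟦⟧-homo-+ p ((- 1ℚ) ·ₚ q) t | ⟦⟧-homo-· (- 1ℚ) q t = minus-one (⟦ p ⟧ t) (⟦ q ⟧ t)
  ∂r≗0 : ∀ t → ⟦ ∂ r ⟧ t ≡ 0ℚ
  ∂r≗0 t rewrite ∂-homo-+ p ((- 1ℚ) ·ₚ q) t | ∂-homo-· (- 1ℚ) q t | ∂p≗∂q t =
    trans (minus-one (⟦ ∂ q ⟧ t) (⟦ ∂ q ⟧ t)) (ℚ.+-inverseʳ (⟦ ∂ q ⟧ t))

∫from : ℕ → ℚ[t] → ℚ[t]
∫from k []      = []
∫from k (c ∷ p) = (+ 1 / suc k) * c ∷ ∫from (suc k) p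

∫ : ℚ[t] → ℚ[t]
∫ p = 0ℚ ∷ ∫from 0 p

coeff-∫from : ∀ k p n → fromℕ (suc (n ℕ.+ k)) * coeff (∫from k p) n ≡ coeff p n
coeff-∫from k []      n       = ℚ.*-zeroʳ (fromℕ (suc (n ℕ.+ k)))
coeff-∫from k (c ∷ p) zero    = begin
  fromℕ (suc k) * ((+ 1 / suc k) * c)
    ≡⟨ solve 3 (λ N r c → N :* (r :* c) := (r :* N) :* c) refl (fromℕ (suc k)) (+ 1 / suc k) c ⟩
  ((+ 1 / suc k) * fromℕ (suc k)) * c
    ≡⟨ cong (_* c) (1/[1+k]*[1+k]≡1 k) ⟩
  1ℚ * c
    ≡⟨ ℚ.*-identityˡ c ⟩
  c
    ∎
  where open ≡-Reasoning
coeff-∫from k (c ∷ p) (suc n) =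
  trans (cong (λ m → fromℕ (suc m) * coeff (∫from (suc k) p) n) (sym (ℕ.+-suc n k)))
        (coeff-∫from (suc k) p n)

∂∫ : ∀ p t → ⟦ ∂ (∫ p) ⟧ t ≡ ⟦ p ⟧ t
∂∫ p = coeff-ext (∂ (∫ p)) p λ n → begin
  coeff (∂ (∫ p)) n
    ≡⟨ coeff-∂ (∫ p) n ⟩
  fromℕ (suc n) * coeff (∫from 0 p) n
    ≡⟨ cong (λ m → fromℕ (suc m) * coeff (∫from 0 p) n) (ℕ.+-identityʳ n) ⟨
  fromℕ (suc (n ℕ.+ 0)) * coeff (∫from 0 p) n
    ≡⟨ coeff-∫from 0 p n ⟩
  coeff p n
    ∎
  where open ≡-Reasoning

⟦∫⟧-at-0 : ∀ p → ⟦ ∫ p ⟧ 0ℚ ≡ 0ℚ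
⟦∫⟧-at-0 p = ⟦⟧-at-0 (∫ p)

∫-substitution : ∀ f g v w c → (∀ s → w * ⟦ f ⟧ (v + w * s) ≡ c * ⟦ g ⟧ s) →
                 ⟦ ∫ f ⟧ (v + w) - ⟦ ∫ f ⟧ v ≡ c * ⟦ ∫ g ⟧ 1ℚ
∫-substitution f g v w c w·f∘L≗c·g = begin
  ⟦ ∫ f ⟧ (v + w) - ⟦ ∫ f ⟧ v
    ≡⟨ cong (λ y → ⟦ ∫ f ⟧ (v + y) - ⟦ ∫ f ⟧ v) (ℚ.*-identityʳ w) ⟨
  ⟦ ∫ f ⟧ (v + w * 1ℚ) - ⟦ ∫ f ⟧ v
    ≡⟨ ⟦F⟧ 1ℚ ⟨
  ⟦ F ⟧ 1ℚ
    ≡⟨ ∂-injective F G ∂F≗∂G (trans (⟦F⟧ 0ℚ) F₀≡G₀) 1ℚ ⟩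
  ⟦ G ⟧ 1ℚ
    ≡⟨ ⟦⟧-homo-· c (∫ g) 1ℚ ⟩
  c * ⟦ ∫ g ⟧ 1ℚ
    ∎
  where
  open ≡-Reasoning
  -- F(s) = ∫_v^{v+ws} f and G(s) = c ∫_0^s g have equal derivatives and vanish at 0.
  F = ∫ f ∘ₚ affine v w +ₚ (- ⟦ ∫ f ⟧ v ∷ [])
  G = c ·ₚ ∫ g
  ⟦F⟧ : ∀ s → ⟦ F ⟧ s ≡ ⟦ ∫ f ⟧ (v + w * s) - ⟦ ∫ f ⟧ v
  ⟦F⟧ s = trans (⟦⟧-homo-+ (∫ f ∘ₚ affine v w) (- ⟦ ∫ f ⟧ v ∷ []) s)
    (cong₂ _+_ (trans (⟦⟧-homo-∘ (∫ f) (affine v w) s) (cong ⟦ ∫ f ⟧ (⟦affine⟧ v w s)))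
               (⟦const⟧ (- ⟦ ∫ f ⟧ v) s))
  ∂F≗∂G : ∀ s → ⟦ ∂ F ⟧ s ≡ ⟦ ∂ G ⟧ s
  ∂F≗∂G s = begin
    ⟦ ∂ F ⟧ s
      ≡⟨ ∂-homo-+ (∫ f ∘ₚ affine v w) (- ⟦ ∫ f ⟧ v ∷ []) s ⟩
    ⟦ ∂ (∫ f ∘ₚ affine v w) ⟧ s + ⟦ ∂ (- ⟦ ∫ f ⟧ v ∷ []) ⟧ s
      ≡⟨ cong₂ _+_ (∂-chain (∫ f) (affine v w) s) (∂-const (- ⟦ ∫ f ⟧ v) s) ⟩
    ⟦ ∂ (affine v w) ⟧ s * ⟦ ∂ (∫ f) ⟧ (⟦ affine v w ⟧ s) + 0ℚ
      ≡⟨ ℚ.+-identityʳ _ ⟩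
    ⟦ ∂ (affine v w) ⟧ s * ⟦ ∂ (∫ f) ⟧ (⟦ affine v w ⟧ s)
      ≡⟨ cong₂ _*_ (∂-affine v w s) (trans (∂∫ f _) (cong ⟦ f ⟧ (⟦affine⟧ v w s))) ⟩
    w * ⟦ f ⟧ (v + w * s)
      ≡⟨ w·f∘L≗c·g s ⟩
    c * ⟦ g ⟧ s
      ≡⟨ cong (c *_) (∂∫ g s) ⟨
    c * ⟦ ∂ (∫ g) ⟧ s
      ≡⟨ ∂-homo-· c (∫ g) s ⟨
    ⟦ ∂ G ⟧ s
      ∎
  F₀≡G₀ : ⟦ ∫ f ⟧ (v + w * 0ℚ) - ⟦ ∫ f ⟧ v ≡ ⟦ G ⟧ 0ℚ
  F₀≡G₀ = begin
    ⟦ ∫ f ⟧ (v + w * 0ℚ) - ⟦ ∫ f ⟧ v   ≡⟨ x≈y⇒x∙y⁻¹≈ε (cong ⟦ ∫ f ⟧ (trans (cong (_+_ v) (ℚ.*-zeroʳ w)) (ℚ.+-identityʳ v))) ⟩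
    0ℚ                                  ≡⟨ ℚ.*-zeroʳ c ⟨
    c * 0ℚ                              ≡⟨ cong (c *_) (⟦∫⟧-at-0 g) ⟨
    c * ⟦ ∫ g ⟧ 0ℚ                      ≡⟨ ⟦⟧-homo-· c (∫ g) 0ℚ ⟨
    ⟦ G ⟧ 0ℚ                            ∎

∫-between-roots : ∀ f g (h : ℚ → ℚ) v w p q →
  (∀ t → ⟦ f ⟧ t ≡ (t - (v + w)) ^ p * ((t - v) ^ q * h t)) →
  (∀ s → ⟦ g ⟧ s ≡ (s - 1ℚ) ^ p * (s ^ q * h (v + w * s))) →
  ⟦ ∫ f ⟧ (v + w) - ⟦ ∫ f ⟧ v ≡ w ^ (p ℕ.+ q ℕ.+ 1) * ⟦ ∫ g ⟧ 1ℚ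
∫-between-roots f g h v w p q f≗ g≗ = ∫-substitution f g v w (w ^ (p ℕ.+ q ℕ.+ 1)) λ s →
  let x = v + w * s in begin
  w * ⟦ f ⟧ x
    ≡⟨ cong (w *_) (f≗ x) ⟩
  w * ((x - (v + w)) ^ p * ((x - v) ^ q * h x))
    ≡⟨ cong₂ (λ a b → w * (a ^ p * (b ^ q * h x)))
         (solve 3 (λ v w s → (v :+ w :* s) :- (v :+ w) := w :* (s :- κ 1ℚ)) refl v w s)
         (solve 3 (λ v w s → (v :+ w :* s) :- v := w :* s) refl v w s) ⟩
  w * ((w * (s - 1ℚ)) ^ p * ((w * s) ^ q * h x))
    ≡⟨ cong₂ (λ a b → w * (a * (b * h x))) (^-distrib-* w (s - 1ℚ) p) (^-distrib-* w s q) ⟩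
  w * ((w ^ p * (s - 1ℚ) ^ p) * ((w ^ q * s ^ q) * h x))
    ≡⟨ solve 6 (λ w W V A B H → w :* ((W :* A) :* ((V :* B) :* H)) := ((W :* V) :* (w :* κ 1ℚ)) :* (A :* (B :* H)))
         refl w (w ^ p) (w ^ q) ((s - 1ℚ) ^ p) (s ^ q) (h x) ⟩
  ((w ^ p * w ^ q) * w ^ 1) * ((s - 1ℚ) ^ p * (s ^ q * h x))
    ≡⟨ cong (_* ((s - 1ℚ) ^ p * (s ^ q * h x)))
         (trans (^-homo-* w (p ℕ.+ q) 1) (cong (_* w ^ 1) (^-homo-* w p q))) ⟨
  w ^ (p ℕ.+ q ℕ.+ 1) * ((s - 1ℚ) ^ p * (s ^ q * h x))
    ≡⟨ cong (w ^ (p ℕ.+ q ℕ.+ 1) *_) (g≗ s) ⟨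
  w ^ (p ℕ.+ q ℕ.+ 1) * ⟦ g ⟧ s
    ∎
  where open ≡-Reasoning

-- Polynomials in t over Poly ℓ, specialised at a point x

specialise : ∀ {ℓ} → (Fin ℓ → ℚ) → UPoly ℓ → ℚ[t]
specialise x = map (λ c → eval c x)

infixr 9 _∘ᵤ_

_∘ᵤ_ : ∀ {ℓ} → UPoly ℓ → UPoly ℓ → UPoly ℓ
[]      ∘ᵤ L = []
(c ∷ p) ∘ᵤ L = addU (c ∷ []) (mulU L (p ∘ᵤ L))

module _ {ℓ} (x : Fin ℓ → ℚ) where

  specialise-addU : ∀ p q → specialise x (addU p q) ≡ specialise x p +ₚ specialise x q
  specialise-addU []      q       = refl
  specialise-addU (c ∷ p) []      = refl
  specialise-addU (c ∷ p) (d ∷ q) = cong (eval c x + eval d x ∷_) (specialise-addU p q)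

  specialise-scaleU : ∀ c q → specialise x (scaleU c q) ≡ eval c x ·ₚ specialise x q
  specialise-scaleU c []      = refl
  specialise-scaleU c (d ∷ q) = cong (eval c x * eval d x ∷_) (specialise-scaleU c q)

  specialise-mulU : ∀ p q → specialise x (mulU p q) ≡ specialise x p *ₚ specialise x q
  specialise-mulU []      q = refl
  specialise-mulU (c ∷ p) q
    rewrite specialise-addU (scaleU c q) (con 0ℚ ∷ mulU p q) | specialise-scaleU c q
          | specialise-mulU p q = refl

  specialise-powU : ∀ p n → specialise x (powU p n) ≡ specialise x p ^ₚ n
  specialise-powU p zero    = refl
  specialise-powU p (suc n) rewrite specialise-mulU p (powU p n) | specialise-powU p n = refl

  specialise-prodU : ∀ n f → specialise x (prodU n f) ≡ ∏ₚ n (specialise x ∘ f)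
  specialise-prodU zero    f = refl
  specialise-prodU (suc n) f
    rewrite specialise-mulU (f fzero) (prodU n (f ∘ fsuc)) | specialise-prodU n (f ∘ fsuc) = refl

  specialise-∘ᵤ : ∀ p L → specialise x (p ∘ᵤ L) ≡ specialise x p ∘ₚ specialise x L
  specialise-∘ᵤ []      L = refl
  specialise-∘ᵤ (c ∷ p) L
    rewrite specialise-addU (c ∷ []) (mulU L (p ∘ᵤ L)) | specialise-mulU L (p ∘ᵤ L)
          | specialise-∘ᵤ p L = refl

eval-^P : ∀ {ℓ} (p : Poly ℓ) n x → eval (p ^P n) x ≡ eval p x ^ n
eval-^P p zero    x = refl
eval-^P p (suc n) x = cong (eval p x *_) (eval-^P p n x)

eval-intFrom : ∀ {ℓ} k (F : UPoly ℓ) s x →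
               eval (intFrom k F s) x ≡ eval s x ^ suc k * ⟦ ∫from k (specialise x F) ⟧ (eval s x)
eval-intFrom k []      s x = sym (ℚ.*-zeroʳ (eval s x ^ suc k))
eval-intFrom k (c ∷ F) s x rewrite eval-^P s (suc k) x | eval-intFrom (suc k) F s x =
  solve 4 (λ a S S′ P → a :* S′ :+ (S :* S′) :* P := S′ :* (a :+ S :* P))
    refl ((+ 1 / suc k) * eval c x) (eval s x) (eval s x ^ suc k) (⟦ ∫from (suc k) (specialise x F) ⟧ (eval s x))

eval-integral0 : ∀ {ℓ} (F : UPoly ℓ) s x → eval (integral0 F s) x ≡ ⟦ ∫ (specialise x F) ⟧ (eval s x)
eval-integral0 F s x = trans (eval-intFrom 0 F s x)
  (solve 2 (λ S P → (S :* κ 1ℚ) :* P := κ 0ℚ :+ S :* P) refl (eval s x) (⟦ ∫from 0 (specialise x F) ⟧ (eval s x)))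

tMinusOne : ∀ {ℓ} → UPoly ℓ
tMinusOne = negP (con 1ℚ) ∷ con 1ℚ ∷ []

⟦tMinusOne⟧ : ∀ {ℓ} (x : Fin ℓ → ℚ) s → ⟦ specialise x tMinusOne ⟧ s ≡ s - 1ℚ
⟦tMinusOne⟧ x = solve 1 (λ s → κ (- 1ℚ) :* κ 1ℚ :+ s :* (κ 1ℚ :+ s :* κ 0ℚ) := s :- κ 1ℚ) refl

⟦tU⟧ : ∀ {ℓ} (x : Fin ℓ → ℚ) s → ⟦ specialise x tU ⟧ s ≡ s
⟦tU⟧ x = solve 1 (λ s → κ 0ℚ :+ s :* (κ 1ℚ :+ s :* κ 0ℚ) := s) refl

⟦tMinus⟧ : ∀ {ℓ} (x : Fin ℓ → ℚ) k t → ⟦ specialise x (tMinus k) ⟧ t ≡ t - x k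
⟦tMinus⟧ x k t = solve 2 (λ y t → κ (- 1ℚ) :* y :+ t :* (κ 1ℚ :+ t :* κ 0ℚ) := t :- y) refl (x k) t

-- (s - 1)^p s^q H(v + w s): the integrand of ∫_v^{v+w} after substituting
-- t = v + w s, with the factor w^(p+q) pulled out.
rescale : ∀ {ℓ} → UPoly ℓ → Poly ℓ → Poly ℓ → ℕ → ℕ → UPoly ℓ
rescale H v w p q = mulU (powU tMinusOne p) (mulU (powU tU q) (H ∘ᵤ (v ∷ w ∷ [])))

⟦rescale⟧ : ∀ {ℓ} x (H : UPoly ℓ) v w p q s →
            ⟦ specialise x (rescale H v w p q) ⟧ s
              ≡ (s - 1ℚ) ^ p * (s ^ q * ⟦ specialise x H ⟧ (eval v x + eval w x * s))
⟦rescale⟧ x H v w p q s = begin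
  ⟦ specialise x (rescale H v w p q) ⟧ s
    ≡⟨ cong (λ r → ⟦ r ⟧ s) specialised ⟩
  ⟦ T-1 ^ₚ p *ₚ (T ^ₚ q *ₚ specialise x H ∘ₚ L) ⟧ s
    ≡⟨ trans (⟦⟧-homo-* (T-1 ^ₚ p) (T ^ₚ q *ₚ specialise x H ∘ₚ L) s)
         (cong (_*_ (⟦ T-1 ^ₚ p ⟧ s)) (⟦⟧-homo-* (T ^ₚ q) (specialise x H ∘ₚ L) s)) ⟩
  ⟦ T-1 ^ₚ p ⟧ s * (⟦ T ^ₚ q ⟧ s * ⟦ specialise x H ∘ₚ L ⟧ s)
    ≡⟨ cong₂ _*_ (trans (⟦⟧-homo-^ T-1 p s) (cong (_^ p) (⟦tMinusOne⟧ x s)))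
         (cong₂ _*_ (trans (⟦⟧-homo-^ T q s) (cong (_^ q) (⟦tU⟧ x s)))
           (trans (⟦⟧-homo-∘ (specialise x H) L s) (cong ⟦ specialise x H ⟧ (⟦affine⟧ (eval v x) (eval w x) s)))) ⟩
  (s - 1ℚ) ^ p * (s ^ q * ⟦ specialise x H ⟧ (eval v x + eval w x * s))
    ∎
  where
  open ≡-Reasoning
  T-1 = specialise x tMinusOne
  T   = specialise x tU
  L   = affine (eval v x) (eval w x)
  specialised : specialise x (rescale H v w p q) ≡ T-1 ^ₚ p *ₚ (T ^ₚ q *ₚ specialise x H ∘ₚ L)
  specialised
    rewrite specialise-mulU x (powU tMinusOne p) (mulU (powU tU q) (H ∘ᵤ (v ∷ w ∷ [])))
          | specialise-mulU x (powU tU q) (H ∘ᵤ (v ∷ w ∷ []))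
          | specialise-powU x tMinusOne p | specialise-powU x tU q | specialise-∘ᵤ x H (v ∷ w ∷ [])
    = refl

∣P-between-roots : ∀ {ℓ} (F H : UPoly ℓ) (u v w : Poly ℓ) (hi : (Fin ℓ → ℚ) → ℚ) (p q : ℕ) →
  (∀ x → hi x ≡ eval v x + eval w x) →
  (∀ x t → ⟦ specialise x F ⟧ t ≡ (t - hi x) ^ p * ((t - eval v x) ^ q * ⟦ specialise x H ⟧ t)) →
  (∀ x → eval u x ≡ ⟦ ∫ (specialise x F) ⟧ (hi x) - ⟦ ∫ (specialise x F) ⟧ (eval v x)) →
  (w ^P (p ℕ.+ q ℕ.+ 1)) ∣P u
∣P-between-roots F H u v w hi p q hi≡v+w F≗ u≡ = integral0 G (con 1ℚ) , λ x →
  let ∫F = ⟦ ∫ (specialise x F) ⟧ in begin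
  eval u x
    ≡⟨ u≡ x ⟩
  ∫F (hi x) - ∫F (eval v x)
    ≡⟨ cong (λ y → ∫F y - ∫F (eval v x)) (hi≡v+w x) ⟩
  ∫F (eval v x + eval w x) - ∫F (eval v x)
    ≡⟨ ∫-between-roots (specialise x F) (specialise x G) ⟦ specialise x H ⟧ (eval v x) (eval w x) p q
         (λ t → trans (F≗ x t) (cong (λ y → (t - y) ^ p * _) (hi≡v+w x))) (⟦rescale⟧ x H v w p q) ⟩
  eval w x ^ (p ℕ.+ q ℕ.+ 1) * ⟦ ∫ (specialise x G) ⟧ 1ℚ
    ≡⟨ cong₂ _*_ (eval-^P w (p ℕ.+ q ℕ.+ 1) x) (eval-integral0 G (con 1ℚ) x) ⟨
  eval ((w ^P (p ℕ.+ q ℕ.+ 1)) ⊗ integral0 G (con 1ℚ)) x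
    ∎
  where
  open ≡-Reasoning
  G = rescale H v w p q

eval-sumP : ∀ {ℓ} n (f : Fin n → Poly ℓ) x → eval (sumP n f) x ≡ ∑ (λ k → eval (f k) x)
eval-sumP zero    f x = refl
eval-sumP (suc n) f x = cong (_+_ (eval (f fzero) x)) (eval-sumP n (f ∘ fsuc) x)

eval-applyDer : ∀ {ℓ} (δ : Der ℓ) α x → eval (applyDer δ α) x ≡ ∑ (λ k → α k * eval (δ k) x)
eval-applyDer {ℓ} δ α = eval-sumP ℓ (λ k → con (α k) ⊗ δ k)

coord-diag : ∀ {n} (i : Fin n) → coord i i ≡ 1ℚ
coord-diag i with i ≟ i
... | yes _   = refl
... | no i≢i = contradiction refl i≢i

coord-offdiag : ∀ {n} {i k : Fin n} → k ≢ i → coord i k ≡ 0ℚ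
coord-offdiag {i = i} {k} k≢i with k ≟ i
... | yes k≡i = contradiction k≡i k≢i
... | no _    = refl

∑-coord : ∀ {n} (i : Fin n) (g : Fin n → ℚ) → ∑ (λ k → coord i k * g k) ≡ g i
∑-coord {suc n} i g = begin
  ∑ (λ k → coord i k * g k)
    ≡⟨ sum-remove {i = i} (λ k → coord i k * g k) ⟩
  coord i i * g i + ∑ (λ k → coord i (punchIn i k) * g (punchIn i k))
    ≡⟨ cong₂ _+_ (cong (_* g i) (coord-diag i)) (trans (sum-cong-≗ off-diagonal) (sum-replicate-zero n)) ⟩
  1ℚ * g i + 0ℚ
    ≡⟨ solve 1 (λ y → κ 1ℚ :* y :+ κ 0ℚ := y) refl (g i) ⟩
  g i
    ∎
  where
  open ≡-Reasoning
  off-diagonal : ∀ k → coord i (punchIn i k) * g (punchIn i k) ≡ 0ℚ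
  off-diagonal k =
    trans (cong (_* g (punchIn i k)) (coord-offdiag (punchInᵢ≢i i k))) (ℚ.*-zeroˡ (g (punchIn i k)))

∑-diffForm : ∀ {n} (i j : Fin n) (g : Fin n → ℚ) → ∑ (λ k → diffForm i j k * g k) ≡ g i - g j
∑-diffForm i j g = begin
  ∑ (λ k → diffForm i j k * g k)
    ≡⟨ sum-cong-≗ (λ k → solve 3 (λ a b y → (a :- b) :* y := a :* y :+ κ (- 1ℚ) :* (b :* y))
                           refl (coord i k) (coord j k) (g k)) ⟩
  ∑ (λ k → coord i k * g k + (- 1ℚ) * (coord j k * g k))
    ≡⟨ ∑-distrib-+ (λ k → coord i k * g k) (λ k → (- 1ℚ) * (coord j k * g k)) ⟩
  ∑ (λ k → coord i k * g k) + ∑ (λ k → (- 1ℚ) * (coord j k * g k))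
    ≡⟨ cong₂ _+_ (∑-coord i g) (trans (sym (*-distribˡ-sum (- 1ℚ) (λ k → coord j k * g k)))
                                        (cong (_*_ (- 1ℚ)) (∑-coord j g))) ⟩
  g i + (- 1ℚ) * g j
    ≡⟨ solve 2 (λ y z → y :+ κ (- 1ℚ) :* z := y :- z) refl (g i) (g j) ⟩
  g i - g j
    ∎
  where open ≡-Reasoning

∏-extract : ∀ {n} (i : Fin n) (f g : Fin n → ℚ) → g i ≡ 1ℚ → (∀ k → k ≢ i → f k ≡ g k) →
            ∏ f ≡ f i * ∏ g
∏-extract {suc n} i f g gᵢ≡1 f≗g = begin
  ∏ f
    ≡⟨ ∏-remove {i = i} f ⟩
  f i * ∏ (f ∘ punchIn i)
    ≡⟨ cong (_*_ (f i)) (∏-cong-≗ (λ k → f≗g (punchIn i k) (punchInᵢ≢i i k))) ⟩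
  f i * ∏ (g ∘ punchIn i)
    ≡⟨ cong (λ y → f i * y) (trans (cong (_* ∏ (g ∘ punchIn i)) gᵢ≡1) (ℚ.*-identityˡ _)) ⟨
  f i * (g i * ∏ (g ∘ punchIn i))
    ≡⟨ cong (_*_ (f i)) (∏-remove {i = i} g) ⟨
  f i * ∏ g
    ∎
  where open ≡-Reasoning

⟦integrand⟧ : ∀ {ℓ} x (a : Fin ℓ → ℕ) b t →
              ⟦ specialise x (integrand a b) ⟧ t ≡ t ^ b * ∏ (λ k → (t - x k) ^ a k)
⟦integrand⟧ {ℓ} x a b t = begin
  ⟦ specialise x (integrand a b) ⟧ t
    ≡⟨ cong (λ r → ⟦ r ⟧ t) (trans (specialise-mulU x (powU tU b) P)
         (cong₂ _*ₚ_ (specialise-powU x tU b) (specialise-prodU x ℓ (λ k → powU (tMinus k) (a k))))) ⟩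
  ⟦ specialise x tU ^ₚ b *ₚ ∏ₚ ℓ (λ k → specialise x (powU (tMinus k) (a k))) ⟧ t
    ≡⟨ ⟦⟧-homo-* (specialise x tU ^ₚ b) _ t ⟩
  ⟦ specialise x tU ^ₚ b ⟧ t * ⟦ ∏ₚ ℓ (λ k → specialise x (powU (tMinus k) (a k))) ⟧ t
    ≡⟨ cong₂ _*_ (trans (⟦⟧-homo-^ (specialise x tU) b t) (cong (_^ b) (⟦tU⟧ x t)))
         (trans (⟦⟧-homo-∏ ℓ _ t) (∏-cong-≗ ⟦tMinus^⟧)) ⟩
  t ^ b * ∏ (λ k → (t - x k) ^ a k)
    ∎
  where
  open ≡-Reasoning
  P = prodU ℓ (λ k → powU (tMinus k) (a k))
  ⟦tMinus^⟧ : ∀ k → ⟦ specialise x (powU (tMinus k) (a k)) ⟧ t ≡ (t - x k) ^ a k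
  ⟦tMinus^⟧ k = begin
    ⟦ specialise x (powU (tMinus k) (a k)) ⟧ t   ≡⟨ cong (λ r → ⟦ r ⟧ t) (specialise-powU x (tMinus k) (a k)) ⟩
    ⟦ specialise x (tMinus k) ^ₚ a k ⟧ t         ≡⟨ ⟦⟧-homo-^ (specialise x (tMinus k)) (a k) t ⟩
    ⟦ specialise x (tMinus k) ⟧ t ^ a k          ≡⟨ cong (_^ a k) (⟦tMinus⟧ x k t) ⟩
    (t - x k) ^ a k                              ∎

integrand-extract : ∀ {ℓ} x (a : Fin ℓ → ℕ) b i t →
  ⟦ specialise x (integrand a b) ⟧ t ≡ (t - x i) ^ a i * ⟦ specialise x (integrand (updateAt a i (λ _ → 0)) b) ⟧ t
integrand-extract x a b i t = begin
  ⟦ specialise x (integrand a b) ⟧ t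
    ≡⟨ ⟦integrand⟧ x a b t ⟩
  t ^ b * ∏ (λ k → (t - x k) ^ a k)
    ≡⟨ cong (_*_ (t ^ b)) (∏-extract i _ _ gᵢ≡1 f≗g) ⟩
  t ^ b * ((t - x i) ^ a i * P′)
    ≡⟨ solve 3 (λ T F P → T :* (F :* P) := F :* (T :* P)) refl (t ^ b) ((t - x i) ^ a i) P′ ⟩
  (t - x i) ^ a i * (t ^ b * P′)
    ≡⟨ cong (_*_ ((t - x i) ^ a i)) (⟦integrand⟧ x a′ b t) ⟨
  (t - x i) ^ a i * ⟦ specialise x (integrand a′ b) ⟧ t
    ∎
  where
  open ≡-Reasoning
  a′ = updateAt a i (λ _ → 0)
  P′ = ∏ (λ k → (t - x k) ^ a′ k)
  gᵢ≡1 : (t - x i) ^ a′ i ≡ 1ℚ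
  gᵢ≡1 = cong ((t - x i) ^_) (updateAt-updates i a)
  f≗g : ∀ k → k ≢ i → (t - x k) ^ a k ≡ (t - x k) ^ a′ k
  f≗g k k≢i = cong ((t - x k) ^_) (sym (updateAt-minimal k i a k≢i))

eval-θ : ∀ {ℓ} (a : Fin ℓ → ℕ) b x i → eval (θ a b i) x ≡ ⟦ ∫ (specialise x (integrand a b)) ⟧ (x i)
eval-θ a b x i = eval-integral0 (integrand a b) (var i) x

θ-coord-divisible : ∀ {ℓ} (a : Fin ℓ → ℕ) b i →
                    (linPoly (coord i) ^P (a i ℕ.+ b ℕ.+ 1)) ∣P applyDer (θ a b) (coord i)
θ-coord-divisible a b i =
  ∣P-between-roots (integrand a b) (integrand (updateAt a i (λ _ → 0)) 0)
    (applyDer (θ a b) (coord i)) (con 0ℚ) (linPoly (coord i)) (λ x → x i) (a i) b hi≡ F≗ u≡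
  where
  open ≡-Reasoning
  hi≡ : ∀ x → x i ≡ 0ℚ + eval (linPoly (coord i)) x
  hi≡ x = sym (trans (ℚ.+-identityˡ _) (trans (eval-applyDer var (coord i) x) (∑-coord i x)))
  F≗ : ∀ x t → ⟦ specialise x (integrand a b) ⟧ t
               ≡ (t - x i) ^ a i * ((t - 0ℚ) ^ b * ⟦ specialise x (integrand (updateAt a i (λ _ → 0)) 0) ⟧ t)
  F≗ x t = trans (integrand-extract x a b i t) (cong (_*_ ((t - x i) ^ a i)) (begin
    ⟦ specialise x (integrand a′ b) ⟧ t                 ≡⟨ ⟦integrand⟧ x a′ b t ⟩
    t ^ b * P                                           ≡⟨ cong₂ _*_ (cong (_^ b) (ℚ.+-identityʳ t)) (ℚ.*-identityˡ P) ⟨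
    (t - 0ℚ) ^ b * (1ℚ * P)                             ≡⟨ cong (_*_ ((t - 0ℚ) ^ b)) (⟦integrand⟧ x a′ 0 t) ⟨
    (t - 0ℚ) ^ b * ⟦ specialise x (integrand a′ 0) ⟧ t  ∎))
    where
    a′ = updateAt a i (λ _ → 0)
    P = ∏ (λ k → (t - x k) ^ a′ k)
  u≡ : ∀ x → eval (applyDer (θ a b) (coord i)) x
             ≡ ⟦ ∫ (specialise x (integrand a b)) ⟧ (x i) - ⟦ ∫ (specialise x (integrand a b)) ⟧ 0ℚ
  u≡ x = begin
    eval (applyDer (θ a b) (coord i)) x    ≡⟨ eval-applyDer (θ a b) (coord i) x ⟩
    ∑ (λ k → coord i k * eval (θ a b k) x) ≡⟨ ∑-coord i (λ k → eval (θ a b k) x) ⟩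
    eval (θ a b i) x                       ≡⟨ eval-θ a b x i ⟩
    ∫F (x i)                               ≡⟨ ℚ.+-identityʳ (∫F (x i)) ⟨
    ∫F (x i) - 0ℚ                          ≡⟨ cong (λ y → ∫F (x i) - y) (⟦∫⟧-at-0 (specialise x (integrand a b))) ⟨
    ∫F (x i) - ∫F 0ℚ                       ∎
    where ∫F = ⟦ ∫ (specialise x (integrand a b)) ⟧

θ-diff-divisible : ∀ {ℓ} (a : Fin ℓ → ℕ) b i j → i ≢ j →
                   (linPoly (diffForm i j) ^P (a i ℕ.+ a j ℕ.+ 1)) ∣P applyDer (θ a b) (diffForm i j)
θ-diff-divisible a b i j i≢j =
  ∣P-between-roots (integrand a b) (integrand a″ b)
    (applyDer (θ a b) (diffForm i j)) (var j) (linPoly (diffForm i j)) (λ x → x i) (a i) (a j) hi≡ F≗ u≡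
  where
  open ≡-Reasoning
  a′ = updateAt a i (λ _ → 0)
  a″ = updateAt a′ j (λ _ → 0)
  hi≡ : ∀ x → x i ≡ x j + eval (linPoly (diffForm i j)) x
  hi≡ x = begin
    x i                                   ≡⟨ solve 2 (λ y z → y := z :+ (y :- z)) refl (x i) (x j) ⟩
    x j + (x i - x j)                     ≡⟨ cong (_+_ (x j)) (trans (eval-applyDer var (diffForm i j) x) (∑-diffForm i j x)) ⟨
    x j + eval (linPoly (diffForm i j)) x ∎
  F≗ : ∀ x t → ⟦ specialise x (integrand a b) ⟧ t
               ≡ (t - x i) ^ a i * ((t - x j) ^ a j * ⟦ specialise x (integrand a″ b) ⟧ t)
  F≗ x t = trans (integrand-extract x a b i t) (cong (_*_ ((t - x i) ^ a i))
    (trans (integrand-extract x a′ b j t)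
           (cong (λ n → (t - x j) ^ n * ⟦ specialise x (integrand a″ b) ⟧ t)
                 (updateAt-minimal j i a (i≢j ∘ sym)))))
  u≡ : ∀ x → eval (applyDer (θ a b) (diffForm i j)) x
             ≡ ⟦ ∫ (specialise x (integrand a b)) ⟧ (x i) - ⟦ ∫ (specialise x (integrand a b)) ⟧ (x j)
  u≡ x = begin
    eval (applyDer (θ a b) (diffForm i j)) x    ≡⟨ eval-applyDer (θ a b) (diffForm i j) x ⟩
    ∑ (λ k → diffForm i j k * eval (θ a b k) x) ≡⟨ ∑-diffForm i j (λ k → eval (θ a b k) x) ⟩
    eval (θ a b i) x - eval (θ a b j) x         ≡⟨ cong₂ _-_ (eval-θ a b x i) (eval-θ a b x j) ⟩
    ∫F (x i) - ∫F (x j)                         ∎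
    where ∫F = ⟦ ∫ (specialise x (integrand a b)) ⟧

proposition2p5 : (ℓ : ℕ) → ℓ ≥ 2 → (a : Fin ℓ → ℕ) → (b : ℕ) →
    θ a b ∈D arr a b
proposition2p5 ℓ _ a b (inj₁ i)               = θ-coord-divisible a b i
proposition2p5 ℓ _ a b (inj₂ ((i , j) , i<j)) = θ-diff-divisible a b i j (<⇒≢ i<j)
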